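{- Let $M$ be a binary matrix and let $B$ be an arbitrary branching of $D_M$. Then the number of rows of the $B$-split of $M$ is at most $h(M)\,\gamma(M)$.
   Context: Binary matrices have no all-zero rows. Let $M$ have columns $c_1,\dots,c_n$ and $v_j=\mathrm{supp}_M(c_j)$ (rows with a $1$ in $c_j$). The containment digraph $D_M$ has vertex set $V=\{v_j\}$ and arcs $(v,v')$ whenever $v\subsetneq v'$. The height $h(M)$ is the maximum number of vertices on a directed path in $D_M$. A branching is a set $B$ of arcs such that each vertex has at most one outgoing arc in $B$. $r\in v$ is uncovered in $v$ if no arc $(v',v)\in B$ has $r\in v'$; $U(B)$ is the set of pairs $(r,v)$ with $r\in v\in V$ and $r$ uncovered in $v$. $B^+(v)$ is the set of vertices reachable from $v$ in $(V,B)$, including $v$. The $B$-split of $M$ is the matrix with rows indexed by $U(B)$ and $n$ columns, with entry $1$ at row $(r,v)$, column $j$ iff $v_j\in B^+(v)$ (it has $|U(B)|$ rows). $\gamma(M)$ is the minimum number of rows of a conflict-free row split of $M$ (row split: rows partition into $R_1,\dots,R_m$ with the $i$-th row of $M$ the bitwise OR of $R_i$; conflict-free: no columns $i,j$ and distinct rows $r,r',r''$ with patterns $(1,1),(1,0),(0,1)$ in columns $(i,j)$). -}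

module Defs where

open import Data.Bool using (Bool; true; false)
open import Data.Nat using (ℕ; zero; suc; _≤_)
open import Data.Fin using (Fin; toℕ)
open import Data.Fin.Properties using (any?)
open import Data.Fin.Subset using (Subset; _∈_; _⊂_)
open import Data.Fin.Subset.Properties using (_∈?_)
open import Data.Vec using (Vec; []; _∷_; tabulate)
import Data.Vec.Properties as VecP
import Data.Bool.Properties as BoolP
open import Data.Maybe using (Maybe; just)
import Data.Maybe.Properties as MaybeP
open import Data.List using (List; []; _∷_; _++_; map; filter; length; cartesianProduct; allFin)
open import Data.Product using (Σ; ∃; _×_; _,_; proj₁; proj₂)
open import Relation.Binary.PropositionalEquality using (_≡_; _≢_)
open import Relation.Nullary using (¬_; Dec)
open import Relation.Nullary.Decidable using (_×-dec_; ¬?)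
open import Function.Bundles using (_⇔_)

Matrix : ℕ → ℕ → Set
Matrix m n = Fin m → Fin n → Bool

NoZeroRows : ∀ {m n} → Matrix m n → Set
NoZeroRows {m} {n} M = ∀ (i : Fin m) → ∃ λ (j : Fin n) → M i j ≡ true

supp : ∀ {m n} → Matrix m n → Fin n → Subset m
supp M j = tabulate (λ i → M i j)

IsVertex : ∀ {m n} → Matrix m n → Subset m → Set
IsVertex {m} {n} M v = ∃ λ (j : Fin n) → supp M j ≡ v

Arc : ∀ {m n} → Matrix m n → Subset m → Subset m → Set
Arc M v w = IsVertex M v × IsVertex M w × v ⊂ w

Path : ∀ {m n} → Matrix m n → ℕ → Set
Path {m} M k =
  Σ (Fin k → Subset m) λ p →
    (∀ i → IsVertex M (p i)) ×
    (∀ (i j : Fin k) → toℕ j ≡ suc (toℕ i) → Arc M (p i) (p j))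

IsHeight : ∀ {m n} → Matrix m n → ℕ → Set
IsHeight M h = Path M h × (∀ k → Path M k → k ≤ h)

-- Branchings: a set B of arcs with at most one outgoing arc per vertex,
-- i.e. a partial map 'out' on V sending v to the head of its outgoing arc
-- (values of 'out' at non-vertices are irrelevant).

record Branching {m n} (M : Matrix m n) : Set where
  field
    out    : Subset m → Maybe (Subset m)
    out-arc : ∀ v w → IsVertex M v → out v ≡ just w → Arc M v w
open Branching public

-- r is uncovered in v : no arc (v' , v) ∈ B with r ∈ v'.
-- Since V = { v_j }, quantifying over vertices v' is quantifying over
-- the columns j with v' = v_j.
Covered : ∀ {m n} {M : Matrix m n} → Branching M → Fin m → Subset m → Set
Covered {n = n} {M = M} B r v =
  ∃ λ (j : Fin n) → out B (supp M j) ≡ just v × r ∈ supp M j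

Uncovered : ∀ {m n} {M : Matrix m n} → Branching M → Fin m → Subset m → Set
Uncovered B r v = ¬ Covered B r v

InU : ∀ {m n} {M : Matrix m n} → Branching M → Fin m × Subset m → Set
InU {M = M} B (r , v) = IsVertex M v × r ∈ v × Uncovered B r v

subset-≟ : ∀ {m} (v w : Subset m) → Dec (v ≡ w)
subset-≟ = VecP.≡-dec BoolP._≟_

InU? : ∀ {m n} {M : Matrix m n} (B : Branching M) (p : Fin m × Subset m) → Dec (InU B p)
InU? {M = M} B (r , v) =
  any? (λ j → subset-≟ (supp M j) v)
  ×-dec ((r ∈? v)
  ×-dec ¬? (any? (λ j → MaybeP.≡-dec subset-≟ (out B (supp M j)) (just v)
                        ×-dec (r ∈? supp M j))))

allSubsets : ∀ m → List (Subset m)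
allSubsets zero = [] ∷ []
allSubsets (suc m) = map (true ∷_) (allSubsets m) ++ map (false ∷_) (allSubsets m)

-- |U(B)| : the number of rows of the B-split of M (its rows are indexed by U(B)).
splitRows : ∀ {m n} {M : Matrix m n} → Branching M → ℕ
splitRows {m} B = length (filter (InU? B) (cartesianProduct (allFin m) (allSubsets m)))

-- A row split of M with k rows: a k × n matrix M' and a partition of its
-- rows into R_1,…,R_m (given by part : Fin k → Fin m, R_i = part⁻¹(i)),
-- such that row i of M is the bitwise OR of the rows in R_i.
record RowSplit {m n} (M : Matrix m n) (k : ℕ) : Set where
  field
    M'   : Matrix k n
    part : Fin k → Fin m
    or-rows : ∀ (i : Fin m) (j : Fin n) →
              (M i j ≡ true) ⇔ (∃ λ (r : Fin k) → part r ≡ i × M' r j ≡ true)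
open RowSplit public

ConflictFree : ∀ {k n} → Matrix k n → Set
ConflictFree {k} {n} A =
  ¬ (Σ (Fin n) λ i → Σ (Fin n) λ j →
     Σ (Fin k) λ r → Σ (Fin k) λ r' → Σ (Fin k) λ r'' →
       r ≢ r' × r ≢ r'' × r' ≢ r'' ×
       (A r i ≡ true × A r j ≡ true) ×
       (A r' i ≡ true × A r' j ≡ false) ×
       (A r'' i ≡ false × A r'' j ≡ true))

IsGamma : ∀ {m n} → Matrix m n → ℕ → Set
IsGamma M g =
  (Σ (RowSplit M g) λ s → ConflictFree (M' s)) ×
  (∀ k (s : RowSplit M k) → ConflictFree (M' s) → g ≤ k)

-- Every row (r , v) of a B-split is an incidence r ∈ v of a row in a column
-- support, whatever B is, so it suffices to inject incidences into
-- Fin h × Fin γ.  Fix a conflict-free row split with γ rows and send (r , v) to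
-- (rank v , x), where x is a split row of r with a 1 in a column of support v,
-- and rank v is the number of arcs on a longest directed path of D_M starting
-- at v, so rank v < h.  Conflict-freeness makes the supports of two columns
-- sharing a 1 in a split row comparable, and the rank strictly decreases along
-- strict inclusion; hence (r , v) is recovered from its image.
module Submission where

open import Defs
open import Data.Nat using (ℕ; _≤_; _*_; zero; suc; _<_)
open import Data.Nat.Properties using (suc-injective; <⇒≤; <⇒≢; >⇒≢; ≤∧≢⇒<; ≤-pred)
open import Data.Bool using (true; false; _≟_)
open import Data.Fin using (Fin; toℕ; fromℕ<; combine)
open import Data.Fin.Properties using (any?; injective⇒≤; combine-injective; fromℕ<-injective)
open import Data.Fin.Subset using (Subset; _∈_; _⊆_; _⊂_)
open import Data.Fin.Subset.Properties using (_∈?_; _⊂?_; ⊆-antisym)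
open import Data.Vec using (_∷_)
open import Data.Vec.Properties using (∷-injectiveʳ; lookup∘tabulate; []=⇒lookup; lookup⇒[]=)
open import Data.List using (List; map; length; lookup; cartesianProduct; allFin)
open import Data.List.Relation.Unary.All as All using (All; [])
open import Data.List.Relation.Unary.All.Properties using (all-filter)
open import Data.List.Relation.Unary.AllPairs using ([]; _∷_)
open import Data.List.Relation.Unary.Unique.Propositional using (Unique)
open import Data.List.Relation.Unary.Unique.Propositional.Properties using (map⁺; ++⁺; cartesianProduct⁺; allFin⁺; filter⁺)
open import Data.List.Membership.Propositional.Properties using (∈-map⁻; ∈-lookup)
open import Data.Product using (Σ; ∃; _×_; _,_; proj₁; proj₂)
open import Data.Sum using (_⊎_; inj₁; inj₂)
open import Relation.Binary.PropositionalEquality using (_≡_; _≢_; refl; sym; trans; cong; subst)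
open import Relation.Nullary using (¬_; Dec; yes; no; contradiction)
open import Relation.Nullary.Decidable using (_×-dec_; ¬?)
open import Relation.Unary using (Decidable)
open import Function.Base using (_∘_)
open import Function.Bundles using (Equivalence)

lookup-injective : ∀ {A : Set} {xs : List A} → Unique xs →
                   ∀ i j → lookup xs i ≡ lookup xs j → i ≡ j
lookup-injective (_ ∷ _)   Fin.zero    Fin.zero    _  = refl
lookup-injective (x≢ ∷ _)  Fin.zero    (Fin.suc j) eq = contradiction eq (All.lookup x≢ (∈-lookup j))
lookup-injective (x≢ ∷ _)  (Fin.suc i) Fin.zero    eq = contradiction (sym eq) (All.lookup x≢ (∈-lookup i))
lookup-injective (_ ∷ xs!) (Fin.suc i) (Fin.suc j) eq = cong Fin.suc (lookup-injective xs! i j eq)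

length≤-by-injection : ∀ {A : Set} {P : A → Set} {xs : List A} {k} →
                       Unique xs → All P xs → (f : ∀ {x} → P x → Fin k) →
                       (∀ {x y} (p : P x) (q : P y) → f p ≡ f q → x ≡ y) →
                       length xs ≤ k
length≤-by-injection {P = P} {xs} xs! all f f-injective =
  injective⇒≤ λ {i} {j} eq → lookup-injective xs! i j (f-injective (at i) (at j) eq)
  where
  at : ∀ i → P (lookup xs i)
  at i = All.lookup all (∈-lookup i)

allSubsets-unique : ∀ m → Unique (allSubsets m)
allSubsets-unique zero    = [] ∷ []
allSubsets-unique (suc m) =
  ++⁺ (map⁺ ∷-injectiveʳ (allSubsets-unique m)) (map⁺ ∷-injectiveʳ (allSubsets-unique m)) disjoint
  where
  open import Data.List.Membership.Propositional using () renaming (_∈_ to _∈ₗ_)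
  disjoint : ∀ {p : Subset (suc m)} →
             ¬ (p ∈ₗ map (true ∷_) (allSubsets m) × p ∈ₗ map (false ∷_) (allSubsets m))
  disjoint (p∈ , p∈′) with ∈-map⁻ (true ∷_) p∈ | ∈-map⁻ (false ∷_) p∈′
  ... | _ , _ , refl | _ , _ , ()

-- The largest i ≤ k with P i, and 0 if there is none.
greatest : {P : ℕ → Set} → Decidable P → ℕ → ℕ
greatest P? zero = zero
greatest P? (suc k) with P? (suc k)
... | yes _ = suc k
... | no  _ = greatest P? k

module _ {P : ℕ → Set} (P? : Decidable P) where

  greatest-satisfies : P 0 → ∀ k → P (greatest P? k)
  greatest-satisfies P0 zero = P0
  greatest-satisfies P0 (suc k) with P? (suc k)
  ... | yes Pk = Pk
  ... | no  _  = greatest-satisfies P0 k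

  ≤-greatest : ∀ {j k} → P j → j ≤ k → j ≤ greatest P? k
  ≤-greatest {k = zero}  _  j≤0 = j≤0
  ≤-greatest {k = suc k} Pj j≤k with P? (suc k)
  ... | yes _   = j≤k
  ... | no  ¬Pk = ≤-greatest Pj (≤-pred (≤∧≢⇒< j≤k λ { refl → ¬Pk Pj }))

⊆∧≢⇒⊂ : ∀ {m} {p q : Subset m} → p ⊆ q → p ≢ q → p ⊂ q
⊆∧≢⇒⊂ {p = p} {q} p⊆q p≢q with any? (λ x → (x ∈? q) ×-dec ¬? (x ∈? p))
... | yes witness = p⊆q , witness
... | no  ¬witness = contradiction (⊆-antisym p⊆q q⊆p) p≢q
  where
  q⊆p : q ⊆ p
  q⊆p {x} x∈q with x ∈? p
  ... | yes x∈p = x∈p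
  ... | no  x∉p = contradiction (x , x∈q , x∉p) ¬witness

module _ {m n} (M : Matrix m n) where

  ∈-supp⁻ : ∀ {r j} → r ∈ supp M j → M r j ≡ true
  ∈-supp⁻ {r} {j} r∈ = trans (sym (lookup∘tabulate (λ i → M i j) r)) ([]=⇒lookup r∈)

  ∈-supp⁺ : ∀ {r j} → M r j ≡ true → r ∈ supp M j
  ∈-supp⁺ {r} {j} e = lookup⇒[]= r (supp M j) (trans (lookup∘tabulate (λ i → M i j) r) e)

column-⊆ : ∀ {k n} (A : Matrix k n) {j j′} → ¬ (∃ λ x → A x j ≡ true × A x j′ ≡ false) →
           ∀ x → A x j ≡ true → A x j′ ≡ true
column-⊆ A {j′ = j′} ¬10 x e with A x j′ in eq
... | true  = refl
... | false = contradiction (x , e , eq) ¬10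

module _ {m n k} {M : Matrix m n} (s : RowSplit M k) where

  split-row : ∀ {r j} → M r j ≡ true → ∃ λ x → part s x ≡ r × M' s x j ≡ true
  split-row = Equivalence.to (or-rows s _ _)

  supp-⊆ : ∀ {j j′} → (∀ x → M' s x j ≡ true → M' s x j′ ≡ true) → supp M j ⊆ supp M j′
  supp-⊆ column r∈ with x , x-part , e ← split-row (∈-supp⁻ M r∈) =
    ∈-supp⁺ M (Equivalence.from (or-rows s _ _) (x , x-part , column x e))

  conflictFree⇒supp-comparable : ConflictFree (M' s) → ∀ {x j j′} →
                                 M' s x j ≡ true → M' s x j′ ≡ true →
                                 supp M j ⊆ supp M j′ ⊎ supp M j′ ⊆ supp M j
  conflictFree⇒supp-comparable cf {x} {j} {j′} e e′
    with any? (λ y → (M' s y j ≟ true) ×-dec (M' s y j′ ≟ false))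
       | any? (λ z → (M' s z j′ ≟ true) ×-dec (M' s z j ≟ false))
  ... | no ¬10 | _      = inj₁ (supp-⊆ (column-⊆ (M' s) ¬10))
  ... | _      | no ¬01 = inj₂ (supp-⊆ (column-⊆ (M' s) ¬01))
  ... | yes (y , y1 , y0) | yes (z , z1 , z0) =
    contradiction (j , j′ , x , y , z , x≢y , x≢z , y≢z , (e , e′) , (y1 , y0) , (z0 , z1)) cf
    where
    x≢y : x ≢ y
    x≢y refl = contradiction (trans (sym e′) y0) λ ()
    x≢z : x ≢ z
    x≢z refl = contradiction (trans (sym e) z0) λ ()
    y≢z : y ≢ z
    y≢z refl = contradiction (trans (sym y1) z0) λ ()

module Rank {m n} (M : Matrix m n) where

  Chain : ℕ → Subset m → Set
  Chain zero    v = IsVertex M v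
  Chain (suc k) v = IsVertex M v × ∃ λ j → v ⊂ supp M j × Chain k (supp M j)

  isVertex? : ∀ v → Dec (IsVertex M v)
  isVertex? v = any? (λ j → subset-≟ (supp M j) v)

  chain? : ∀ k v → Dec (Chain k v)
  chain? zero    v = isVertex? v
  chain? (suc k) v = isVertex? v ×-dec any? (λ j → (v ⊂? supp M j) ×-dec chain? k (supp M j))

  chain-vertex : ∀ {k v} → Chain k v → IsVertex M v
  chain-vertex {zero}  iv       = iv
  chain-vertex {suc k} (iv , _) = iv

  chain-⊂ : ∀ {k v w} → v ⊂ w → IsVertex M v → Chain k w → Chain (suc k) v
  chain-⊂ v⊂w iv c with j , refl ← chain-vertex c = iv , j , v⊂w , c

  path-cons : ∀ {k v} (P : Path M (suc k)) → Arc M v (proj₁ P Fin.zero) → Path M (suc (suc k))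
  path-cons {k} {v} (p , p-vertex , p-arc) arc = q , q-vertex , q-arc
    where
    q : Fin (suc (suc k)) → Subset m
    q Fin.zero    = v
    q (Fin.suc i) = p i
    q-vertex : ∀ i → IsVertex M (q i)
    q-vertex Fin.zero    = proj₁ arc
    q-vertex (Fin.suc i) = p-vertex i
    q-arc : ∀ i j → toℕ j ≡ suc (toℕ i) → Arc M (q i) (q j)
    q-arc Fin.zero    (Fin.suc Fin.zero)    _  = arc
    q-arc (Fin.suc i) (Fin.suc j)           eq = p-arc i j (suc-injective eq)
    q-arc Fin.zero    Fin.zero              ()
    q-arc Fin.zero    (Fin.suc (Fin.suc _)) ()
    q-arc (Fin.suc _) Fin.zero              ()

  chain⇒path : ∀ k {v} → Chain k v → Σ (Path M (suc k)) λ P → proj₁ P Fin.zero ≡ v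
  chain⇒path zero {v} iv = ((λ _ → v) , (λ _ → iv) , λ { Fin.zero Fin.zero () }) , refl
  chain⇒path (suc k) {v} (iv , j , v⊂ , c) with P , head ← chain⇒path k c =
    path-cons P (subst (Arc M v) (sym head) (iv , (j , refl) , v⊂)) , refl

  module _ {h} (bounded : ∀ k → Path M k → k ≤ h) where

    chain-length< : ∀ {k v} → Chain k v → k < h
    chain-length< c = bounded _ (proj₁ (chain⇒path _ c))

    rank : Subset m → ℕ
    rank v = greatest (λ i → chain? i v) h

    rank-chain : ∀ {v} → IsVertex M v → Chain (rank v) v
    rank-chain {v} iv = greatest-satisfies (λ i → chain? i v) iv h

    rank<height : ∀ {v} → IsVertex M v → rank v < h
    rank<height iv = chain-length< (rank-chain iv)

    rank-⊂ : ∀ {v w} → v ⊂ w → IsVertex M v → IsVertex M w → rank w < rank v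
    rank-⊂ {v} {w} v⊂w iv iw = ≤-greatest (λ i → chain? i v) longer (<⇒≤ (chain-length< longer))
      where
      longer : Chain (suc (rank w)) v
      longer = chain-⊂ v⊂w iv (rank-chain iw)

    rank-injective : ∀ {v w} → IsVertex M v → IsVertex M w → v ⊆ w ⊎ w ⊆ v →
                     rank v ≡ rank w → v ≡ w
    rank-injective {v} {w} iv iw comparable same with subset-≟ v w
    ... | yes v≡w = v≡w
    ... | no  v≢w with comparable
    ...   | inj₁ v⊆w = contradiction same (>⇒≢ (rank-⊂ (⊆∧≢⇒⊂ v⊆w v≢w) iv iw))
    ...   | inj₂ w⊆v = contradiction same (<⇒≢ (rank-⊂ (⊆∧≢⇒⊂ w⊆v (v≢w ∘ sym)) iw iv))

module Encoding {m n g} (M : Matrix m n) (s : RowSplit M g) (cf : ConflictFree (M' s))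
                {h} (bounded : ∀ k → Path M k → k ≤ h) where
  open Rank M

  Incidence : Fin m × Subset m → Set
  Incidence (r , v) = IsVertex M v × r ∈ v

  Lifts : Fin g → Fin m × Subset m → Set
  Lifts x (r , v) = part s x ≡ r × ∃ λ j → supp M j ≡ v × M' s x j ≡ true

  lift : ∀ {p} → Incidence p → Σ (Fin g) λ x → Lifts x p
  lift ((j , refl) , r∈v) with x , x-part , e ← split-row s (∈-supp⁻ M r∈v) =
    x , x-part , j , refl , e

  lifts-injective : ∀ {x p q} → Lifts x p → Lifts x q →
                    IsVertex M (proj₂ p) → IsVertex M (proj₂ q) →
                    rank bounded (proj₂ p) ≡ rank bounded (proj₂ q) → p ≡ q
  lifts-injective (refl , j , refl , e) (refl , j′ , refl , e′) iv iw same =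
    cong (_ ,_) (rank-injective bounded iv iw (conflictFree⇒supp-comparable s cf e e′) same)

  code : ∀ {p} → Incidence p → Fin (h * g)
  code ι@(iv , _) = combine (fromℕ< (rank<height bounded iv)) (proj₁ (lift ι))

  code-injective : ∀ {p q} (ι : Incidence p) (κ : Incidence q) → code ι ≡ code κ → p ≡ q
  code-injective ι@(iv , _) κ@(iw , _) eq
    with same-rank , same-row ← combine-injective (fromℕ< (rank<height bounded iv)) (proj₁ (lift ι))
                                                  (fromℕ< (rank<height bounded iw)) (proj₁ (lift κ)) eq =
    lifts-injective (proj₂ (lift ι)) (subst (λ x → Lifts x _) (sym same-row) (proj₂ (lift κ)))
                    iv iw (fromℕ<-injective _ _ _ _ same-rank)

theorem8 : ∀ {m n} (M : Matrix m n) → NoZeroRows M →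
           (B : Branching M) → (h g : ℕ) → IsHeight M h → IsGamma M g →
           splitRows B ≤ h * g
theorem8 {m} M _ B h g (_ , bounded) ((s , cf) , _) =
  length≤-by-injection
    (filter⁺ (InU? B) (cartesianProduct⁺ (allFin⁺ m) (allSubsets-unique m)))
    (all-filter (InU? B) (cartesianProduct (allFin m) (allSubsets m)))
    (λ (iv , r∈v , _) → code (iv , r∈v))
    (λ (iv , r∈v , _) (iw , r∈w , _) → code-injective (iv , r∈v) (iw , r∈w))
  where open Encoding M s cf bounded
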